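{- For integers $n\ge1$ and $0\le p\le n-1$, the (signed) Stirling number of the first kind satisfies $$s(n,n-p)=\frac{(n-1)!}{(n-p-1)!}\sum_{0\le k_1,\ldots,k_p\le p}\binom{n+K-1}{K}\binom{K}{k_1,\ldots,k_p}\delta_{p,\sum_m mk_m}\left(\frac{ -1}{2!}\right)^{k_1}\left(\frac{ -1}{3!}\right)^{k_2}\cdots\left(\frac{ -1}{(p+1)!}\right)^{k_p},$$ where $K:=k_1+\cdots+k_p$.
   Context: The signed Stirling numbers of the first kind are defined by $x(x-1)\cdots(x-n+1)=\sum_k s(n,k)x^k$ (e.g. $s(2,1)=-1$). Notation: $\binom{K}{k_1,\ldots,k_p}=\frac{K!}{k_1!\cdots k_p!}\delta_{K,k_1+\cdots+k_p}$; for $p=0$ the sum has the single term $1$. -}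

module Defs where

open import Data.Nat as ℕ using (ℕ; zero; suc; _∸_; _!)
open import Data.Nat.Properties using (_!≢0)
open import Data.Nat.Combinatorics using (_C_)
open import Data.Integer as ℤ using (ℤ; +_)
open import Data.Rational as ℚ using (ℚ; _/_)
open import Data.List using (List; []; _∷_)
open import Data.Vec using (Vec; []; _∷_)
open import Relation.Nullary using (yes; no)

-- Signed Stirling numbers of the first kind, via the defining identity
--   x(x-1)...(x-n+1) = Σ_k s(n,k) x^k.
-- Integer polynomials are coefficient lists, lowest degree first.

addPoly : List ℤ → List ℤ → List ℤ
addPoly []       q        = q
addPoly p        []       = p
addPoly (a ∷ p)  (b ∷ q)  = (a ℤ.+ b) ∷ addPoly p q

scalePoly : ℤ → List ℤ → List ℤ
scalePoly c []      = []
scalePoly c (a ∷ p) = (c ℤ.* a) ∷ scalePoly c p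

mulXMinus : ℤ → List ℤ → List ℤ
mulXMinus c p = addPoly (+ 0 ∷ p) (scalePoly (ℤ.- c) p)

fallingPoly : ℕ → List ℤ
fallingPoly zero    = + 1 ∷ []
fallingPoly (suc n) = mulXMinus (+ n) (fallingPoly n)

coeff : List ℤ → ℕ → ℤ
coeff []      k       = + 0
coeff (a ∷ p) zero    = a
coeff (a ∷ p) (suc k) = coeff p k

stirling1 : ℕ → ℕ → ℤ
stirling1 n k = coeff (fallingPoly n) k

_^ℚ_ : ℚ → ℕ → ℚ
q ^ℚ zero  = ℚ.1ℚ
q ^ℚ suc k = q ℚ.* (q ^ℚ k)

ℕtoℚ : ℕ → ℚ
ℕtoℚ m = (+ m) / 1

invFact : ℕ → ℚ
invFact m = (+ 1) / (m !) where instance _ = m !≢0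

divFact : ℕ → ℕ → ℚ
divFact a b = (+ a) / (b !) where instance _ = b !≢0

sumUpTo : ℕ → (ℕ → ℚ) → ℚ
sumUpTo zero    g = g 0
sumUpTo (suc b) g = sumUpTo b g ℚ.+ g (suc b)

sumTuples : (m b : ℕ) → (Vec ℕ m → ℚ) → ℚ
sumTuples zero    b f = f []
sumTuples (suc m) b f = sumUpTo b (λ j → sumTuples m b (λ v → f (j ∷ v)))

-- Quantities attached to a tuple k = (k₁,…,k_p), stored as a Vec whose
-- entry at 0-based position i is k_{i+1}.

totalK : ∀ {m} → Vec ℕ m → ℕ
totalK []       = 0
totalK (k ∷ ks) = k ℕ.+ totalK ks

weightedSum : ∀ {m} → ℕ → Vec ℕ m → ℕ
weightedSum o []       = 0
weightedSum o (k ∷ ks) = suc o ℕ.* k ℕ.+ weightedSum (suc o) ks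

prodInvFact : ∀ {m} → Vec ℕ m → ℚ
prodInvFact []       = ℚ.1ℚ
prodInvFact (k ∷ ks) = invFact k ℚ.* prodInvFact ks

-- multinomial coefficient binom(K; k₁,…,k_p) with K = k₁+…+k_p
-- (the Kronecker delta in its definition is then 1)
multinomial : ∀ {m} → Vec ℕ m → ℚ
multinomial ks = ℕtoℚ (totalK ks !) ℚ.* prodInvFact ks

powProd : ∀ {m} → ℕ → Vec ℕ m → ℚ
powProd o []       = ℚ.1ℚ
powProd o (k ∷ ks) = ((ℚ.- invFact (suc (suc o))) ^ℚ k) ℚ.* powProd (suc o) ks

deltaℚ : ℕ → ℕ → ℚ
deltaℚ a b with a ℕ.≟ b
... | yes _ = ℚ.1ℚ
... | no  _ = ℚ.0ℚ

summand : (n p : ℕ) → Vec ℕ p → ℚ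
summand n p ks =
  ℕtoℚ ((n ℕ.+ totalK ks ∸ 1) C totalK ks)
  ℚ.* multinomial ks
  ℚ.* deltaℚ p (weightedSum 0 ks)
  ℚ.* powProd 0 ks

stirlingRHS : ℕ → ℕ → ℚ
stirlingRHS n p =
  divFact ((n ∸ 1) !) (n ∸ p ∸ 1) ℚ.* sumTuples p p (summand n p)

-- With h(t) = Σ_{i≥1} -t^i/(i+1)! = 1 - (e^t - 1)/t, the tuple sum is the
-- coefficient of t^p in Σ_K C(n+K-1, K) h^K = (t/(e^t - 1))^n, times
-- (n-1)!/(n-p-1)!. No power series are formed: the tuple sum is read as a
-- linear functional applied to exp(x h(t)), on which K and Σ m k_m act as the
-- Euler operators x∂ₓ and t∂ₜ. This yields for the coefficients Φ(a, q) of
-- (t/(e^t - 1))^(a+1) the identity t F′ = F - t F - F² in coefficient form,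
--   (a+1) Φ(a+1, q+1) = (a-q) Φ(a, q+1) - (a+1) Φ(a, q),
-- which turns (q+r)!/r! · Φ(q+r, q) into a solution of the Stirling recurrence
-- s(n+1, k+1) = s(n, k) - n s(n, k+1) with the same boundary values.
module Submission where

open import Defs
open import Data.Nat using (ℕ; _≤_; _∸_)
open import Data.Rational using (ℚ)
open import Data.Rational.Literals using (fromℤ)
open import Relation.Binary.PropositionalEquality using (_≡_)

open import Data.Empty using (⊥-elim)
open import Data.Product using (_,_)
open import Data.List using ([]; _∷_)
open import Data.Vec using (Vec; []; _∷_)
open import Data.Nat as ℕ using (zero; suc; _!; s≤s; z≤n)
import Data.Nat.Properties as ℕP
open import Data.Nat.Properties using (_!≢0; _!*_!≢0)
open import Data.Nat.Combinatorics using (_C_; nCk≡n!/k![n-k]!; k![n∸k]!∣n!)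
open import Data.Nat.DivMod using (m/n*n≡m)
open import Data.Integer as ℤ using (ℤ; +_; -[1+_])
import Data.Integer.Properties as ℤP
open import Data.Rational as ℚ using (_/_; 0ℚ; 1ℚ; _+_; _*_; -_)
import Data.Rational.Properties as ℚP
import Data.Rational.Unnormalised as ℚᵘ
import Data.Rational.Unnormalised.Properties as ℚᵘP
open import Relation.Nullary using (¬_; yes; no)
open import Relation.Binary.PropositionalEquality
  using (refl; sym; trans; cong; cong₂; subst; module ≡-Reasoning)
open import Data.Rational.Solver using (module +-*-Solver)
open +-*-Solver using (solve; _:+_; _:*_; :-_; _:=_; con)

/1≡fromℤ : ∀ i → i / 1 ≡ fromℤ i
/1≡fromℤ i = ℚP.↥p/↧p≡p (fromℤ i)

fromℤ-homo-+ : ∀ i j → fromℤ (i ℤ.+ j) ≡ fromℤ i + fromℤ j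
fromℤ-homo-+ i j = sym (trans
  (cong (_/ 1) (cong₂ ℤ._+_ (ℤP.*-identityʳ i) (ℤP.*-identityʳ j)))
  (/1≡fromℤ (i ℤ.+ j)))

fromℤ-homo-* : ∀ i j → fromℤ (i ℤ.* j) ≡ fromℤ i * fromℤ j
fromℤ-homo-* i j = sym (/1≡fromℤ (i ℤ.* j))

fromℤ-homo‿- : ∀ i → fromℤ (ℤ.- i) ≡ - fromℤ i
fromℤ-homo‿- (+ zero)  = refl
fromℤ-homo‿- (+ suc n) = refl
fromℤ-homo‿- -[1+ n ]  = refl

ℕtoℚ≡fromℤ : ∀ m → ℕtoℚ m ≡ fromℤ (+ m)
ℕtoℚ≡fromℤ m = /1≡fromℤ (+ m)

ℕtoℚ-homo-+ : ∀ m k → ℕtoℚ (m ℕ.+ k) ≡ ℕtoℚ m + ℕtoℚ k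
ℕtoℚ-homo-+ m k = begin
  ℕtoℚ (m ℕ.+ k)              ≡⟨ ℕtoℚ≡fromℤ (m ℕ.+ k) ⟩
  fromℤ (+ m ℤ.+ + k)         ≡⟨ fromℤ-homo-+ (+ m) (+ k) ⟩
  fromℤ (+ m) + fromℤ (+ k)   ≡⟨ sym (cong₂ _+_ (ℕtoℚ≡fromℤ m) (ℕtoℚ≡fromℤ k)) ⟩
  ℕtoℚ m + ℕtoℚ k             ∎
  where open ≡-Reasoning

ℕtoℚ-homo-* : ∀ m k → ℕtoℚ (m ℕ.* k) ≡ ℕtoℚ m * ℕtoℚ k
ℕtoℚ-homo-* m k = begin
  ℕtoℚ (m ℕ.* k)              ≡⟨ ℕtoℚ≡fromℤ (m ℕ.* k) ⟩
  fromℤ (+ (m ℕ.* k))         ≡⟨ cong fromℤ (ℤP.pos-* m k) ⟩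
  fromℤ (+ m ℤ.* + k)         ≡⟨ fromℤ-homo-* (+ m) (+ k) ⟩
  fromℤ (+ m) * fromℤ (+ k)   ≡⟨ sym (cong₂ _*_ (ℕtoℚ≡fromℤ m) (ℕtoℚ≡fromℤ k)) ⟩
  ℕtoℚ m * ℕtoℚ k             ∎
  where open ≡-Reasoning

fromℚᵘ-homo-* : ∀ x y → ℚ.fromℚᵘ (x ℚᵘ.* y) ≡ ℚ.fromℚᵘ x * ℚ.fromℚᵘ y
fromℚᵘ-homo-* x y = ℚP.toℚᵘ-injective (ℚᵘP.≃-trans (ℚP.toℚᵘ-fromℚᵘ _)
  (ℚᵘP.≃-trans (ℚᵘP.*-cong (ℚᵘP.≃-sym (ℚP.toℚᵘ-fromℚᵘ x)) (ℚᵘP.≃-sym (ℚP.toℚᵘ-fromℚᵘ y)))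
    (ℚᵘP.≃-sym (ℚP.toℚᵘ-homo-* (ℚ.fromℚᵘ x) (ℚ.fromℚᵘ y)))))

-- Both sides are normalisations of unnormalised fractions, which compute.
[a/d]*d≡a : ∀ a d .{{_ : ℕ.NonZero d}} → (+ a / d) * ℕtoℚ d ≡ ℕtoℚ a
[a/d]*d≡a a (suc k) = trans
  (sym (fromℚᵘ-homo-* (ℚᵘ.mkℚᵘ (+ a) k) (ℚᵘ.mkℚᵘ (+ suc k) 0)))
  (ℚP.fromℚᵘ-cong {ℚᵘ.mkℚᵘ (+ a) k ℚᵘ.* ℚᵘ.mkℚᵘ (+ suc k) 0} {ℚᵘ.mkℚᵘ (+ a) 0}
    (ℚᵘ.*≡* (trans (ℤP.*-identityʳ _) (cong (λ d → + a ℤ.* + suc d) (sym (ℕP.*-identityʳ k))))))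

*-cancelʳ-invertible : ∀ {x y} d e → e * d ≡ 1ℚ → x * d ≡ y * d → x ≡ y
*-cancelʳ-invertible {x} {y} d e e*d≡1 x*d≡y*d = begin
  x              ≡⟨ sym (ℚP.*-identityʳ x) ⟩
  x * 1ℚ         ≡⟨ cong (x *_) d*e≡1 ⟨
  x * (d * e)    ≡⟨ ℚP.*-assoc x d e ⟨
  x * d * e      ≡⟨ cong (_* e) x*d≡y*d ⟩
  y * d * e      ≡⟨ ℚP.*-assoc y d e ⟩
  y * (d * e)    ≡⟨ cong (y *_) d*e≡1 ⟩
  y * 1ℚ         ≡⟨ ℚP.*-identityʳ y ⟩
  y              ∎
  where
  open ≡-Reasoning
  d*e≡1 : d * e ≡ 1ℚ
  d*e≡1 = trans (ℚP.*-comm d e) e*d≡1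

invFact-inverseˡ : ∀ m → invFact m * ℕtoℚ (m !) ≡ 1ℚ
invFact-inverseˡ m = [a/d]*d≡a 1 (m !) where instance _ = m !≢0

divFact≡*invFact : ∀ a b → divFact a b ≡ ℕtoℚ a * invFact b
divFact≡*invFact a b = *-cancelʳ-invertible (ℕtoℚ (b !)) (invFact b) (invFact-inverseˡ b) (begin
  divFact a b * ℕtoℚ (b !)            ≡⟨ [a/d]*d≡a a (b !) ⟩
  ℕtoℚ a                              ≡⟨ ℚP.*-identityʳ (ℕtoℚ a) ⟨
  ℕtoℚ a * 1ℚ                         ≡⟨ cong (ℕtoℚ a *_) (invFact-inverseˡ b) ⟨
  ℕtoℚ a * (invFact b * ℕtoℚ (b !))   ≡⟨ ℚP.*-assoc (ℕtoℚ a) (invFact b) (ℕtoℚ (b !)) ⟨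
  ℕtoℚ a * invFact b * ℕtoℚ (b !)     ∎)
  where
  open ≡-Reasoning
  instance _ = b !≢0

invFact-suc : ∀ j → invFact (suc j) * ℕtoℚ (suc j) ≡ invFact j
invFact-suc j = *-cancelʳ-invertible (ℕtoℚ (j !)) (invFact j) (invFact-inverseˡ j) (begin
  invFact (suc j) * ℕtoℚ (suc j) * ℕtoℚ (j !)
    ≡⟨ ℚP.*-assoc (invFact (suc j)) (ℕtoℚ (suc j)) (ℕtoℚ (j !)) ⟩
  invFact (suc j) * (ℕtoℚ (suc j) * ℕtoℚ (j !))
    ≡⟨ cong (invFact (suc j) *_) (ℕtoℚ-homo-* (suc j) (j !)) ⟨
  invFact (suc j) * ℕtoℚ (suc j !)
    ≡⟨ trans (invFact-inverseˡ (suc j)) (sym (invFact-inverseˡ j)) ⟩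
  invFact j * ℕtoℚ (j !) ∎)
  where open ≡-Reasoning

invFact-one : invFact 1 ≡ 1ℚ
invFact-one = trans (sym (ℚP.*-identityʳ (invFact 1))) (invFact-inverseˡ 1)

-- The Stirling recurrence

coeff-addPoly : ∀ P Q k → coeff (addPoly P Q) k ≡ coeff P k ℤ.+ coeff Q k
coeff-addPoly []      Q       k       = sym (ℤP.+-identityˡ _)
coeff-addPoly (a ∷ P) []      k       = sym (ℤP.+-identityʳ _)
coeff-addPoly (a ∷ P) (b ∷ Q) zero    = refl
coeff-addPoly (a ∷ P) (b ∷ Q) (suc k) = coeff-addPoly P Q k

coeff-scalePoly : ∀ c P k → coeff (scalePoly c P) k ≡ c ℤ.* coeff P k
coeff-scalePoly c []      k       = sym (ℤP.*-zeroʳ c)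
coeff-scalePoly c (a ∷ P) zero    = refl
coeff-scalePoly c (a ∷ P) (suc k) = coeff-scalePoly c P k

coeff-mulXMinus-zero : ∀ c P → coeff (mulXMinus c P) 0 ≡ ℤ.- c ℤ.* coeff P 0
coeff-mulXMinus-zero c P = trans (coeff-addPoly (+ 0 ∷ P) (scalePoly (ℤ.- c) P) 0)
  (trans (ℤP.+-identityˡ _) (coeff-scalePoly (ℤ.- c) P 0))

coeff-mulXMinus-suc : ∀ c P k →
  coeff (mulXMinus c P) (suc k) ≡ coeff P k ℤ.+ ℤ.- c ℤ.* coeff P (suc k)
coeff-mulXMinus-suc c P k = trans (coeff-addPoly (+ 0 ∷ P) (scalePoly (ℤ.- c) P) (suc k))
  (cong (λ x → coeff P k ℤ.+ x) (coeff-scalePoly (ℤ.- c) P (suc k)))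

stirling1-suc-zero : ∀ n → stirling1 (suc n) 0 ≡ + 0
stirling1-suc-zero zero    = refl
stirling1-suc-zero (suc n) = begin
  stirling1 (suc (suc n)) 0                  ≡⟨ coeff-mulXMinus-zero (+ suc n) (fallingPoly (suc n)) ⟩
  ℤ.- (+ suc n) ℤ.* stirling1 (suc n) 0      ≡⟨ cong (ℤ.- (+ suc n) ℤ.*_) (stirling1-suc-zero n) ⟩
  ℤ.- (+ suc n) ℤ.* + 0                      ≡⟨ ℤP.*-zeroʳ (ℤ.- (+ suc n)) ⟩
  + 0                                        ∎
  where open ≡-Reasoning

stirling1-suc-suc : ∀ n k →
  stirling1 (suc n) (suc k) ≡ stirling1 n k ℤ.+ ℤ.- (+ n) ℤ.* stirling1 n (suc k)
stirling1-suc-suc n = coeff-mulXMinus-suc (+ n) (fallingPoly n)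

stirling1-> : ∀ {n k} → n ℕ.< k → stirling1 n k ≡ + 0
stirling1-> {zero}  {suc k} _          = refl
stirling1-> {suc n} {suc k} (s≤s n<k) = begin
  stirling1 (suc n) (suc k)                                ≡⟨ stirling1-suc-suc n k ⟩
  stirling1 n k ℤ.+ ℤ.- (+ n) ℤ.* stirling1 n (suc k)      ≡⟨ cong₂ (λ x y → x ℤ.+ ℤ.- (+ n) ℤ.* y)
                                                                 (stirling1-> n<k) (stirling1-> (ℕP.m≤n⇒m≤1+n n<k)) ⟩
  + 0 ℤ.+ ℤ.- (+ n) ℤ.* + 0                                ≡⟨ trans (ℤP.+-identityˡ _) (ℤP.*-zeroʳ (ℤ.- (+ n))) ⟩
  + 0                                                      ∎
  where open ≡-Reasoning

stirling1-diag : ∀ n → stirling1 n n ≡ + 1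
stirling1-diag zero    = refl
stirling1-diag (suc n) = begin
  stirling1 (suc n) (suc n)                                ≡⟨ stirling1-suc-suc n n ⟩
  stirling1 n n ℤ.+ ℤ.- (+ n) ℤ.* stirling1 n (suc n)      ≡⟨ cong₂ (λ x y → x ℤ.+ ℤ.- (+ n) ℤ.* y)
                                                                 (stirling1-diag n) (stirling1-> (ℕP.n<1+n n)) ⟩
  + 1 ℤ.+ ℤ.- (+ n) ℤ.* + 0                                ≡⟨ cong (λ x → + 1 ℤ.+ x) (ℤP.*-zeroʳ (ℤ.- (+ n))) ⟩
  + 1                                                      ∎
  where open ≡-Reasoning

fromℤ-stirling1-suc-suc : ∀ n k → fromℤ (stirling1 (suc n) (suc k))
  ≡ fromℤ (stirling1 n k) + - ℕtoℚ n * fromℤ (stirling1 n (suc k))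
fromℤ-stirling1-suc-suc n k = begin
  fromℤ (stirling1 (suc n) (suc k))
    ≡⟨ cong fromℤ (stirling1-suc-suc n k) ⟩
  fromℤ (stirling1 n k ℤ.+ ℤ.- (+ n) ℤ.* stirling1 n (suc k))
    ≡⟨ fromℤ-homo-+ (stirling1 n k) _ ⟩
  fromℤ (stirling1 n k) + fromℤ (ℤ.- (+ n) ℤ.* stirling1 n (suc k))
    ≡⟨ cong (λ x → fromℤ (stirling1 n k) + x) (fromℤ-homo-* (ℤ.- (+ n)) (stirling1 n (suc k))) ⟩
  fromℤ (stirling1 n k) + fromℤ (ℤ.- (+ n)) * fromℤ (stirling1 n (suc k))
    ≡⟨ cong (λ x → fromℤ (stirling1 n k) + x * fromℤ (stirling1 n (suc k)))
         (trans (fromℤ-homo‿- (+ n)) (cong -_ (sym (ℕtoℚ≡fromℤ n)))) ⟩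
  fromℤ (stirling1 n k) + - ℕtoℚ n * fromℤ (stirling1 n (suc k)) ∎
  where open ≡-Reasoning

-- The rising factorial (a+1)(a+2)⋯(a+K) = C(a+K, K) K!
rising : ℕ → ℕ → ℚ
rising a K = ℕtoℚ ((a ℕ.+ K) C K) * ℕtoℚ (K !)

[a+K]CK*[K!*a!]≡[a+K]! : ∀ a K → ((a ℕ.+ K) C K) ℕ.* (K ! ℕ.* a !) ≡ (a ℕ.+ K) !
[a+K]CK*[K!*a!]≡[a+K]! a K = begin
  ((a ℕ.+ K) C K) ℕ.* (K ! ℕ.* a !)                   ≡⟨ cong (λ x → ((a ℕ.+ K) C K) ℕ.* (K ! ℕ.* x !))
                                                            (ℕP.m+n∸n≡m a K) ⟨
  ((a ℕ.+ K) C K) ℕ.* (K ! ℕ.* (a ℕ.+ K ∸ K) !)       ≡⟨ cong (ℕ._* (K ! ℕ.* (a ℕ.+ K ∸ K) !))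
                                                            (nCk≡n!/k![n-k]! K≤a+K) ⟩
  (a ℕ.+ K) ! ℕ./ (K ! ℕ.* (a ℕ.+ K ∸ K) !) ℕ.* (K ! ℕ.* (a ℕ.+ K ∸ K) !)
                                                      ≡⟨ m/n*n≡m (k![n∸k]!∣n! K≤a+K) ⟩
  (a ℕ.+ K) !                                         ∎
  where
  open ≡-Reasoning
  K≤a+K = ℕP.m≤n+m K a
  instance _ = K !* (a ℕ.+ K ∸ K) !≢0

rising≡[a+K]!/a! : ∀ a K → rising a K ≡ ℕtoℚ ((a ℕ.+ K) !) * invFact a
rising≡[a+K]!/a! a K = *-cancelʳ-invertible (ℕtoℚ (a !)) (invFact a) (invFact-inverseˡ a) (begin
  rising a K * ℕtoℚ (a !)
    ≡⟨ ℚP.*-assoc (ℕtoℚ ((a ℕ.+ K) C K)) (ℕtoℚ (K !)) (ℕtoℚ (a !)) ⟩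
  ℕtoℚ ((a ℕ.+ K) C K) * (ℕtoℚ (K !) * ℕtoℚ (a !))
    ≡⟨ cong (ℕtoℚ ((a ℕ.+ K) C K) *_) (ℕtoℚ-homo-* (K !) (a !)) ⟨
  ℕtoℚ ((a ℕ.+ K) C K) * ℕtoℚ (K ! ℕ.* a !)
    ≡⟨ trans (sym (ℕtoℚ-homo-* ((a ℕ.+ K) C K) (K ! ℕ.* a !))) (cong ℕtoℚ ([a+K]CK*[K!*a!]≡[a+K]! a K)) ⟩
  ℕtoℚ ((a ℕ.+ K) !)
    ≡⟨ trans (sym (ℚP.*-identityʳ _)) (cong (ℕtoℚ ((a ℕ.+ K) !) *_) (sym (invFact-inverseˡ a))) ⟩
  ℕtoℚ ((a ℕ.+ K) !) * (invFact a * ℕtoℚ (a !))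
    ≡⟨ ℚP.*-assoc (ℕtoℚ ((a ℕ.+ K) !)) (invFact a) (ℕtoℚ (a !)) ⟨
  ℕtoℚ ((a ℕ.+ K) !) * invFact a * ℕtoℚ (a !) ∎)
  where open ≡-Reasoning

rising-zero : ∀ a → rising a 0 ≡ 1ℚ
rising-zero a = begin
  rising a 0                          ≡⟨ rising≡[a+K]!/a! a 0 ⟩
  ℕtoℚ ((a ℕ.+ 0) !) * invFact a      ≡⟨ cong (λ x → ℕtoℚ (x !) * invFact a) (ℕP.+-identityʳ a) ⟩
  ℕtoℚ (a !) * invFact a              ≡⟨ trans (ℚP.*-comm (ℕtoℚ (a !)) (invFact a)) (invFact-inverseˡ a) ⟩
  1ℚ                                  ∎
  where open ≡-Reasoning

rising-suc-first : ∀ a K → rising a (suc K) ≡ ℕtoℚ (suc a) * rising (suc a) K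
rising-suc-first a K = begin
  rising a (suc K)
    ≡⟨ rising≡[a+K]!/a! a (suc K) ⟩
  ℕtoℚ ((a ℕ.+ suc K) !) * invFact a
    ≡⟨ cong₂ (λ x y → ℕtoℚ (x !) * y) (ℕP.+-suc a K) (sym (invFact-suc a)) ⟩
  ℕtoℚ ((suc a ℕ.+ K) !) * (invFact (suc a) * ℕtoℚ (suc a))
    ≡⟨ reorder (ℕtoℚ ((suc a ℕ.+ K) !)) (invFact (suc a)) (ℕtoℚ (suc a)) ⟩
  ℕtoℚ (suc a) * (ℕtoℚ ((suc a ℕ.+ K) !) * invFact (suc a))
    ≡⟨ cong (ℕtoℚ (suc a) *_) (rising≡[a+K]!/a! (suc a) K) ⟨
  ℕtoℚ (suc a) * rising (suc a) K ∎
  where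
  open ≡-Reasoning
  reorder : ∀ x y z → x * (y * z) ≡ z * (x * y)
  reorder = solve 3 (λ x y z → x :* (y :* z) := z :* (x :* y)) refl

rising-suc-last : ∀ a K → rising a (suc K) ≡ ℕtoℚ (suc a ℕ.+ K) * rising a K
rising-suc-last a K = begin
  rising a (suc K)
    ≡⟨ rising≡[a+K]!/a! a (suc K) ⟩
  ℕtoℚ ((a ℕ.+ suc K) !) * invFact a
    ≡⟨ cong (λ x → ℕtoℚ (x !) * invFact a) (ℕP.+-suc a K) ⟩
  ℕtoℚ (suc (a ℕ.+ K) ℕ.* (a ℕ.+ K) !) * invFact a
    ≡⟨ cong (_* invFact a) (ℕtoℚ-homo-* (suc (a ℕ.+ K)) ((a ℕ.+ K) !)) ⟩
  ℕtoℚ (suc a ℕ.+ K) * ℕtoℚ ((a ℕ.+ K) !) * invFact a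
    ≡⟨ ℚP.*-assoc (ℕtoℚ (suc a ℕ.+ K)) _ _ ⟩
  ℕtoℚ (suc a ℕ.+ K) * (ℕtoℚ ((a ℕ.+ K) !) * invFact a)
    ≡⟨ cong (ℕtoℚ (suc a ℕ.+ K) *_) (rising≡[a+K]!/a! a K) ⟨
  ℕtoℚ (suc a ℕ.+ K) * rising a K ∎
  where open ≡-Reasoning

sumUpTo-cong : ∀ b {f g : ℕ → ℚ} → (∀ j → f j ≡ g j) → sumUpTo b f ≡ sumUpTo b g
sumUpTo-cong zero    f≡g = f≡g 0
sumUpTo-cong (suc b) f≡g = cong₂ _+_ (sumUpTo-cong b f≡g) (f≡g (suc b))

*-distribˡ-sumUpTo : ∀ b c (f : ℕ → ℚ) → c * sumUpTo b f ≡ sumUpTo b (λ j → c * f j)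
*-distribˡ-sumUpTo zero    c f = refl
*-distribˡ-sumUpTo (suc b) c f = trans (ℚP.*-distribˡ-+ c (sumUpTo b f) (f (suc b)))
  (cong (_+ c * f (suc b)) (*-distribˡ-sumUpTo b c f))

sumUpTo-distrib-+ : ∀ b (f g : ℕ → ℚ) →
  sumUpTo b (λ j → f j + g j) ≡ sumUpTo b f + sumUpTo b g
sumUpTo-distrib-+ zero    f g = refl
sumUpTo-distrib-+ (suc b) f g = trans (cong (_+ (f (suc b) + g (suc b))) (sumUpTo-distrib-+ b f g))
  (interchange (sumUpTo b f) (sumUpTo b g) (f (suc b)) (g (suc b)))
  where
  interchange : ∀ w x y z → (w + x) + (y + z) ≡ (w + y) + (x + z)
  interchange = solve 4 (λ w x y z → (w :+ x) :+ (y :+ z) := (w :+ y) :+ (x :+ z)) refl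

sumUpTo-zero : ∀ b {f : ℕ → ℚ} → (∀ j → f j ≡ 0ℚ) → sumUpTo b f ≡ 0ℚ
sumUpTo-zero zero    f≡0 = f≡0 0
sumUpTo-zero (suc b) f≡0 = cong₂ _+_ (sumUpTo-zero b f≡0) (f≡0 (suc b))

sumUpTo-head : ∀ b {f : ℕ → ℚ} → (∀ j → f (suc j) ≡ 0ℚ) → sumUpTo b f ≡ f 0
sumUpTo-head zero    _   = refl
sumUpTo-head (suc b) {f} tail≡0 =
  trans (cong₂ _+_ (sumUpTo-head b tail≡0) (tail≡0 b)) (ℚP.+-identityʳ (f 0))

-- The discrete form of x d/dx e^(cx) = c x e^(cx).
sumUpTo-lowerIndex : ∀ (w X : ℕ → ℚ) c → (∀ j → ℕtoℚ (suc j) * w (suc j) ≡ c * w j) → ∀ b →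
  sumUpTo b (λ j → w j * (ℕtoℚ j * X j)) + c * (w b * X (suc b))
  ≡ c * sumUpTo b (λ j → w j * X (suc j))
sumUpTo-lowerIndex w X c w-rec zero = zero-term (w 0) (X 0) (c * (w 0 * X 1))
  where
  zero-term : ∀ u x z → u * (0ℚ * x) + z ≡ z
  zero-term = solve 3 (λ u x z → u :* (con 0ℚ :* x) :+ z := z) refl
sumUpTo-lowerIndex w X c w-rec (suc b) = begin
  sumUpTo b (λ j → w j * (ℕtoℚ j * X j)) + w (suc b) * (ℕtoℚ (suc b) * X (suc b)) + c * next
    ≡⟨ cong (λ x → sumUpTo b (λ j → w j * (ℕtoℚ j * X j)) + x + c * next) top ⟩
  sumUpTo b (λ j → w j * (ℕtoℚ j * X j)) + c * (w b * X (suc b)) + c * next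
    ≡⟨ cong (_+ c * next) (sumUpTo-lowerIndex w X c w-rec b) ⟩
  c * sumUpTo b (λ j → w j * X (suc j)) + c * next
    ≡⟨ ℚP.*-distribˡ-+ c _ next ⟨
  c * sumUpTo (suc b) (λ j → w j * X (suc j)) ∎
  where
  open ≡-Reasoning
  next = w (suc b) * X (suc (suc b))
  regroup : ∀ u n x → u * (n * x) ≡ (n * u) * x
  regroup = solve 3 (λ u n x → u :* (n :* x) := (n :* u) :* x) refl
  top : w (suc b) * (ℕtoℚ (suc b) * X (suc b)) ≡ c * (w b * X (suc b))
  top = trans (regroup (w (suc b)) (ℕtoℚ (suc b)) (X (suc b)))
    (trans (cong (_* X (suc b)) (w-rec b)) (ℚP.*-assoc c (w b) (X (suc b))))

sumRange : ℕ → ℕ → (ℕ → ℚ) → ℚ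
sumRange o zero    h = 0ℚ
sumRange o (suc m) h = h (suc o) + sumRange (suc o) m h

sumRange-cong : ∀ o m {f g : ℕ → ℚ} → (∀ i → f i ≡ g i) → sumRange o m f ≡ sumRange o m g
sumRange-cong o zero    f≡g = refl
sumRange-cong o (suc m) f≡g = cong₂ _+_ (f≡g (suc o)) (sumRange-cong (suc o) m f≡g)

*-distribˡ-sumRange : ∀ o m c (h : ℕ → ℚ) → c * sumRange o m h ≡ sumRange o m (λ i → c * h i)
*-distribˡ-sumRange o zero    c h = ℚP.*-zeroʳ c
*-distribˡ-sumRange o (suc m) c h = trans (ℚP.*-distribˡ-+ c (h (suc o)) (sumRange (suc o) m h))
  (cong (λ x → c * h (suc o) + x) (*-distribˡ-sumRange (suc o) m c h))

sumRange-suc : ∀ o m (h : ℕ → ℚ) → sumRange (suc o) m h ≡ sumRange o m (λ i → h (suc i))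
sumRange-suc o zero    h = refl
sumRange-suc o (suc m) h = cong (λ x → h (suc (suc o)) + x) (sumRange-suc (suc o) m h)

sumRange-snoc : ∀ o m (h : ℕ → ℚ) → sumRange o (suc m) h ≡ sumRange o m h + h (suc (o ℕ.+ m))
sumRange-snoc o zero    h = trans (ℚP.+-comm (h (suc o)) 0ℚ)
  (cong (λ i → 0ℚ + h (suc i)) (sym (ℕP.+-identityʳ o)))
sumRange-snoc o (suc m) h = begin
  h (suc o) + sumRange (suc o) (suc m) h
    ≡⟨ cong (λ x → h (suc o) + x) (sumRange-snoc (suc o) m h) ⟩
  h (suc o) + (sumRange (suc o) m h + h (suc (suc o ℕ.+ m)))
    ≡⟨ ℚP.+-assoc (h (suc o)) (sumRange (suc o) m h) _ ⟨
  h (suc o) + sumRange (suc o) m h + h (suc (suc o ℕ.+ m))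
    ≡⟨ cong (λ i → h (suc o) + sumRange (suc o) m h + h (suc i)) (ℕP.+-suc o m) ⟨
  h (suc o) + sumRange (suc o) m h + h (suc (o ℕ.+ suc m)) ∎
  where open ≡-Reasoning

sumUpTo-sumRange-comm : ∀ b o m (H : ℕ → ℕ → ℚ) →
  sumUpTo b (λ j → sumRange o m (H j)) ≡ sumRange o m (λ i → sumUpTo b (λ j → H j i))
sumUpTo-sumRange-comm b o zero    H = sumUpTo-zero b (λ _ → refl)
sumUpTo-sumRange-comm b o (suc m) H =
  trans (sumUpTo-distrib-+ b (λ j → H j (suc o)) (λ j → sumRange (suc o) m (H j)))
    (cong (λ x → sumUpTo b (λ j → H j (suc o)) + x) (sumUpTo-sumRange-comm b (suc o) m H))

sumTuples-cong : ∀ m b {f g : Vec ℕ m → ℚ} → (∀ v → f v ≡ g v) → sumTuples m b f ≡ sumTuples m b g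
sumTuples-cong zero    b f≡g = f≡g []
sumTuples-cong (suc m) b f≡g = sumUpTo-cong b (λ j → sumTuples-cong m b (λ v → f≡g (j ∷ v)))

*-distribˡ-sumTuples : ∀ m b c (f : Vec ℕ m → ℚ) →
  c * sumTuples m b f ≡ sumTuples m b (λ v → c * f v)
*-distribˡ-sumTuples zero    b c f = refl
*-distribˡ-sumTuples (suc m) b c f = trans (*-distribˡ-sumUpTo b c _)
  (sumUpTo-cong b (λ j → *-distribˡ-sumTuples m b c (λ v → f (j ∷ v))))

-- Exponential tuple sums

-- The coefficient of t^i in h(t) = 1 - (e^t - 1)/t.
hCoeff : ℕ → ℚ
hCoeff i = - invFact (suc i)

expWeight : ℕ → ℕ → ℚ
expWeight i j = invFact j * (hCoeff i ^ℚ j)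

absorb : ℕ → ℕ → (ℕ → ℕ → ℚ) → ℕ → ℕ → ℚ
absorb o j F K W = F (j ℕ.+ K) (suc o ℕ.* j ℕ.+ W)

-- The sum over 0 ≤ j_{o+1}, …, j_{o+m} ≤ b of
--   Π_i (hCoeff i ^ j_i / j_i!) · F (Σ_i j_i) (Σ_i i j_i),
-- i.e. the linear functional x^K t^W ↦ F K W applied to (a truncation of)
-- exp(x · Σ_{i=o+1}^{o+m} hCoeff i t^i).
expSum : ℕ → ℕ → ℕ → (ℕ → ℕ → ℚ) → ℚ
expSum b o zero    F = F 0 0
expSum b o (suc m) F = sumUpTo b (λ j → expWeight (suc o) j * expSum b (suc o) m (absorb o j F))

expSum-cong : ∀ b o m {F G : ℕ → ℕ → ℚ} → (∀ K W → F K W ≡ G K W) → expSum b o m F ≡ expSum b o m G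
expSum-cong b o zero    F≡G = F≡G 0 0
expSum-cong b o (suc m) F≡G =
  sumUpTo-cong b (λ j → cong (expWeight (suc o) j *_) (expSum-cong b (suc o) m (λ K W → F≡G _ _)))

*-distribˡ-expSum : ∀ b o m c (F : ℕ → ℕ → ℚ) →
  c * expSum b o m F ≡ expSum b o m (λ K W → c * F K W)
*-distribˡ-expSum b o zero    c F = refl
*-distribˡ-expSum b o (suc m) c F = trans (*-distribˡ-sumUpTo b c _) (sumUpTo-cong b (λ j → begin
  c * (expWeight (suc o) j * expSum b (suc o) m (absorb o j F))
    ≡⟨ swap c (expWeight (suc o) j) _ ⟩
  expWeight (suc o) j * (c * expSum b (suc o) m (absorb o j F))
    ≡⟨ cong (expWeight (suc o) j *_) (*-distribˡ-expSum b (suc o) m c (absorb o j F)) ⟩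
  expWeight (suc o) j * expSum b (suc o) m (λ K W → c * absorb o j F K W) ∎))
  where
  open ≡-Reasoning
  swap : ∀ x y z → x * (y * z) ≡ y * (x * z)
  swap = solve 3 (λ x y z → x :* (y :* z) := y :* (x :* z)) refl

expSum-distrib-+ : ∀ b o m (F G : ℕ → ℕ → ℚ) →
  expSum b o m (λ K W → F K W + G K W) ≡ expSum b o m F + expSum b o m G
expSum-distrib-+ b o zero    F G = refl
expSum-distrib-+ b o (suc m) F G = trans
  (sumUpTo-cong b (λ j → trans
    (cong (expWeight (suc o) j *_) (expSum-distrib-+ b (suc o) m (absorb o j F) (absorb o j G)))
    (ℚP.*-distribˡ-+ (expWeight (suc o) j) _ _)))
  (sumUpTo-distrib-+ b _ _)

expSum-zero : ∀ b o m {F : ℕ → ℕ → ℚ} → (∀ K W → F K W ≡ 0ℚ) → expSum b o m F ≡ 0ℚ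
expSum-zero b o zero    F≡0 = F≡0 0 0
expSum-zero b o (suc m) F≡0 = sumUpTo-zero b (λ j →
  trans (cong (expWeight (suc o) j *_) (expSum-zero b (suc o) m (λ K W → F≡0 _ _)))
    (ℚP.*-zeroʳ (expWeight (suc o) j)))

sumTuples≡expSum : ∀ m b o (F : ℕ → ℕ → ℚ) →
  sumTuples m b (λ ks → F (totalK ks) (weightedSum o ks) * (prodInvFact ks * powProd o ks))
  ≡ expSum b o m F
sumTuples≡expSum zero    b o F = unit (F 0 0)
  where
  unit : ∀ x → x * (1ℚ * 1ℚ) ≡ x
  unit = solve 1 (λ x → x :* (con 1ℚ :* con 1ℚ) := x) refl
sumTuples≡expSum (suc m) b o F = sumUpTo-cong b (λ j → begin
  sumTuples m b (λ v → absorb o j F (totalK v) (weightedSum (suc o) v)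
                         * ((invFact j * prodInvFact v) * (hCoeff (suc o) ^ℚ j * powProd (suc o) v)))
    ≡⟨ sumTuples-cong m b (λ v → regroup (absorb o j F (totalK v) (weightedSum (suc o) v))
                                                  (invFact j) (prodInvFact v) _ (powProd (suc o) v)) ⟩
  sumTuples m b (λ v → expWeight (suc o) j
                         * (absorb o j F (totalK v) (weightedSum (suc o) v) * (prodInvFact v * powProd (suc o) v)))
    ≡⟨ *-distribˡ-sumTuples m b (expWeight (suc o) j) _ ⟨
  expWeight (suc o) j
    * sumTuples m b (λ v → absorb o j F (totalK v) (weightedSum (suc o) v) * (prodInvFact v * powProd (suc o) v))
    ≡⟨ cong (expWeight (suc o) j *_) (sumTuples≡expSum m b (suc o) (absorb o j F)) ⟩
  expWeight (suc o) j * expSum b (suc o) m (absorb o j F) ∎)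
  where
  open ≡-Reasoning
  regroup : ∀ f x y z w → f * ((x * y) * (z * w)) ≡ (x * z) * (f * (y * w))
  regroup = solve 5 (λ f x y z w → f :* ((x :* y) :* (z :* w)) := (x :* z) :* (f :* (y :* w))) refl

expWeight-suc : ∀ i j → ℕtoℚ (suc j) * expWeight i (suc j) ≡ hCoeff i * expWeight i j
expWeight-suc i j = trans
  (regroup (ℕtoℚ (suc j)) (invFact (suc j)) (hCoeff i) (hCoeff i ^ℚ j))
  (cong (λ x → hCoeff i * (x * (hCoeff i ^ℚ j))) (invFact-suc j))
  where
  regroup : ∀ n f c x → n * (f * (c * x)) ≡ c * ((f * n) * x)
  regroup = solve 4 (λ n f c x → n :* (f :* (c :* x)) := c :* ((f :* n) :* x)) refl

-- The Euler operators x∂ₓ and t∂ₜ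

VanishesAbove : ℕ → (ℕ → ℕ → ℚ) → Set
VanishesAbove p F = ∀ K W → p ℕ.< W → F K W ≡ 0ℚ

-- Precomposition with multiplication by x t^i.
mulXT : ℕ → (ℕ → ℕ → ℚ) → ℕ → ℕ → ℚ
mulXT i F K W = F (suc K) (i ℕ.+ W)

absorb-vanishesAbove : ∀ {p F} o j → VanishesAbove p F → VanishesAbove p (absorb o j F)
absorb-vanishesAbove {p} o j F↑ K W p<W = F↑ _ _ (ℕP.<-≤-trans p<W (ℕP.m≤n+m W (suc o ℕ.* j)))

absorb-beyond : ∀ {p b F} o → p ℕ.≤ b → VanishesAbove p F → ∀ K W → absorb o (suc b) F K W ≡ 0ℚ
absorb-beyond {p} {b} o p≤b F↑ K W = F↑ _ _ (begin-strict
  p                          ≤⟨ p≤b ⟩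
  b                          <⟨ ℕP.n<1+n b ⟩
  suc b                      ≤⟨ ℕP.m≤n*m (suc b) (suc o) ⟩
  suc o ℕ.* suc b            ≤⟨ ℕP.m≤m+n (suc o ℕ.* suc b) W ⟩
  suc o ℕ.* suc b ℕ.+ W      ∎)
  where open ℕP.≤-Reasoning

absorb-suc : ∀ o j F K W → absorb o (suc j) F K W ≡ absorb o j (mulXT (suc o) F) K W
absorb-suc o j F K W = cong (F (suc (j ℕ.+ K))) (begin
  suc o ℕ.* suc j ℕ.+ W         ≡⟨ cong (ℕ._+ W) (ℕP.*-suc (suc o) j) ⟩
  suc o ℕ.+ suc o ℕ.* j ℕ.+ W   ≡⟨ ℕP.+-assoc (suc o) (suc o ℕ.* j) W ⟩
  suc o ℕ.+ (suc o ℕ.* j ℕ.+ W) ∎)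
  where open ≡-Reasoning

mulXT-absorb : ∀ i o j F K W → mulXT i (absorb o j F) K W ≡ absorb o j (mulXT i F) K W
mulXT-absorb i o j F K W = cong₂ F (ℕP.+-suc j K) (begin
  suc o ℕ.* j ℕ.+ (i ℕ.+ W)     ≡⟨ ℕP.+-assoc (suc o ℕ.* j) i W ⟨
  suc o ℕ.* j ℕ.+ i ℕ.+ W       ≡⟨ cong (ℕ._+ W) (ℕP.+-comm (suc o ℕ.* j) i) ⟩
  i ℕ.+ suc o ℕ.* j ℕ.+ W       ≡⟨ ℕP.+-assoc i (suc o ℕ.* j) W ⟩
  i ℕ.+ (suc o ℕ.* j ℕ.+ W)     ∎)
  where open ≡-Reasoning

expSum-x∂ₓ-head : ∀ {p b F} m o → p ℕ.≤ b → VanishesAbove p F →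
  sumUpTo b (λ j → expWeight (suc o) j * (ℕtoℚ j * expSum b (suc o) m (absorb o j F)))
  ≡ hCoeff (suc o) * expSum b o (suc m) (mulXT (suc o) F)
expSum-x∂ₓ-head {p} {b} {F} m o p≤b F↑ = begin
  S                                      ≡⟨ ℚP.+-identityʳ S ⟨
  S + 0ℚ                                 ≡⟨ cong (λ x → S + x) last≡0 ⟨
  S + c * (w b * X (suc b))              ≡⟨ sumUpTo-lowerIndex w X c (expWeight-suc (suc o)) b ⟩
  c * sumUpTo b (λ j → w j * X (suc j))  ≡⟨ cong (c *_) (sumUpTo-cong b (λ j →
                                              cong (w j *_) (expSum-cong b (suc o) m (absorb-suc o j F)))) ⟩
  c * expSum b o (suc m) (mulXT (suc o) F) ∎
  where
  open ≡-Reasoning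
  c = hCoeff (suc o)
  w = expWeight (suc o)
  X : ℕ → ℚ
  X j = expSum b (suc o) m (absorb o j F)
  S = sumUpTo b (λ j → w j * (ℕtoℚ j * X j))
  last≡0 : c * (w b * X (suc b)) ≡ 0ℚ
  last≡0 = begin
    c * (w b * X (suc b))  ≡⟨ cong (λ x → c * (w b * x)) (expSum-zero b (suc o) m (absorb-beyond o p≤b F↑)) ⟩
    c * (w b * 0ℚ)         ≡⟨ cong (c *_) (ℚP.*-zeroʳ (w b)) ⟩
    c * 0ℚ                 ≡⟨ ℚP.*-zeroʳ c ⟩
    0ℚ                     ∎

-- On exp(x g(t)), g = Σ_{i=o+1}^{o+m} hCoeff i t^i, the operator α x∂ₓ + β t∂ₜ
-- acts as multiplication by x (α g + β t g′) = Σ_i (α + β i) hCoeff i · x t^i;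
-- the vanishing hypothesis makes the truncation at b harmless.
expSum-euler : ∀ {p b} α β → p ℕ.≤ b → ∀ m o F → VanishesAbove p F →
  expSum b o m (λ K W → (α * ℕtoℚ K + β * ℕtoℚ W) * F K W)
  ≡ sumRange o m (λ i → (α + β * ℕtoℚ i) * hCoeff i * expSum b o m (mulXT i F))
expSum-euler α β p≤b zero o F F↑ = vanish α β (F 0 0)
  where
  vanish : ∀ α β x → (α * 0ℚ + β * 0ℚ) * x ≡ 0ℚ
  vanish = solve 3 (λ α β x → (α :* con 0ℚ :+ β :* con 0ℚ) :* x := con 0ℚ) refl
expSum-euler {p} {b} α β p≤b (suc m) o F F↑ = begin
  expSum b o (suc m) (λ K W → D K W * F K W)
    ≡⟨ sumUpTo-cong b split ⟩
  sumUpTo b (λ j → co * (w j * (ℕtoℚ j * X j)) + w j * P j)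
    ≡⟨ sumUpTo-distrib-+ b _ _ ⟩
  sumUpTo b (λ j → co * (w j * (ℕtoℚ j * X j))) + sumUpTo b (λ j → w j * P j)
    ≡⟨ cong₂ _+_ (sym (*-distribˡ-sumUpTo b co _)) tail ⟩
  co * sumUpTo b (λ j → w j * (ℕtoℚ j * X j)) + sumRange (suc o) m h
    ≡⟨ cong (λ x → co * x + sumRange (suc o) m h) (expSum-x∂ₓ-head m o p≤b F↑) ⟩
  co * (hCoeff (suc o) * expSum b o (suc m) (mulXT (suc o) F)) + sumRange (suc o) m h
    ≡⟨ cong (_+ sumRange (suc o) m h) (ℚP.*-assoc co _ _) ⟨
  sumRange o (suc m) h ∎
  where
  open ≡-Reasoning
  D : ℕ → ℕ → ℚ
  D K W = α * ℕtoℚ K + β * ℕtoℚ W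
  co = α + β * ℕtoℚ (suc o)
  w = expWeight (suc o)
  X P : ℕ → ℚ
  X j = expSum b (suc o) m (absorb o j F)
  P j = expSum b (suc o) m (λ K W → D K W * absorb o j F K W)
  h : ℕ → ℚ
  h i = (α + β * ℕtoℚ i) * hCoeff i * expSum b o (suc m) (mulXT i F)

  D-absorb : ∀ j K W → D (j ℕ.+ K) (suc o ℕ.* j ℕ.+ W) ≡ co * ℕtoℚ j + D K W
  D-absorb j K W = trans
    (cong₂ (λ x y → α * x + β * y) (ℕtoℚ-homo-+ j K)
      (trans (ℕtoℚ-homo-+ (suc o ℕ.* j) W) (cong (_+ ℕtoℚ W) (ℕtoℚ-homo-* (suc o) j))))
    (collect α β (ℕtoℚ j) (ℕtoℚ K) (ℕtoℚ (suc o)) (ℕtoℚ W))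
    where
    collect : ∀ α β J K O W → α * (J + K) + β * (O * J + W) ≡ (α + β * O) * J + (α * K + β * W)
    collect = solve 6 (λ α β J K O W →
      α :* (J :+ K) :+ β :* (O :* J :+ W) := (α :+ β :* O) :* J :+ (α :* K :+ β :* W)) refl

  split : ∀ j → w j * expSum b (suc o) m (absorb o j (λ K W → D K W * F K W))
              ≡ co * (w j * (ℕtoℚ j * X j)) + w j * P j
  split j = begin
    w j * expSum b (suc o) m (λ K W → D (j ℕ.+ K) (suc o ℕ.* j ℕ.+ W) * absorb o j F K W)
      ≡⟨ cong (w j *_) (expSum-cong b (suc o) m (λ K W →
           trans (cong (_* absorb o j F K W) (D-absorb j K W))
             (ℚP.*-distribʳ-+ (absorb o j F K W) (co * ℕtoℚ j) (D K W)))) ⟩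
    w j * expSum b (suc o) m (λ K W → co * ℕtoℚ j * absorb o j F K W + D K W * absorb o j F K W)
      ≡⟨ cong (w j *_) (expSum-distrib-+ b (suc o) m _ _) ⟩
    w j * (expSum b (suc o) m (λ K W → co * ℕtoℚ j * absorb o j F K W) + P j)
      ≡⟨ cong (λ x → w j * (x + P j)) (*-distribˡ-expSum b (suc o) m (co * ℕtoℚ j) (absorb o j F)) ⟨
    w j * (co * ℕtoℚ j * X j + P j)
      ≡⟨ expand (w j) co (ℕtoℚ j) (X j) (P j) ⟩
    co * (w j * (ℕtoℚ j * X j)) + w j * P j ∎
    where
    expand : ∀ w c n x y → w * (c * n * x + y) ≡ c * (w * (n * x)) + w * y
    expand = solve 5 (λ w c n x y → w :* (c :* n :* x :+ y) := c :* (w :* (n :* x)) :+ w :* y) refl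

  tail : sumUpTo b (λ j → w j * P j) ≡ sumRange (suc o) m h
  tail = begin
    sumUpTo b (λ j → w j * P j)
      ≡⟨ sumUpTo-cong b (λ j → trans
           (cong (w j *_) (expSum-euler α β p≤b m (suc o) (absorb o j F) (absorb-vanishesAbove o j F↑)))
           (*-distribˡ-sumRange (suc o) m (w j) _)) ⟩
    sumUpTo b (λ j → sumRange (suc o) m (λ i → w j * (coef i * expSum b (suc o) m (mulXT i (absorb o j F)))))
      ≡⟨ sumUpTo-sumRange-comm b (suc o) m _ ⟩
    sumRange (suc o) m (λ i → sumUpTo b (λ j → w j * (coef i * expSum b (suc o) m (mulXT i (absorb o j F)))))
      ≡⟨ sumRange-cong (suc o) m (λ i → trans
           (sumUpTo-cong b (λ j → trans (swap (w j) (coef i) _)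
             (cong (λ x → coef i * (w j * x)) (expSum-cong b (suc o) m (mulXT-absorb i o j F)))))
           (sym (*-distribˡ-sumUpTo b (coef i) _))) ⟩
    sumRange (suc o) m h ∎
    where
    coef : ℕ → ℚ
    coef i = (α + β * ℕtoℚ i) * hCoeff i
    swap : ∀ x y z → x * (y * z) ≡ y * (x * z)
    swap = solve 3 (λ x y z → x :* (y :* z) := y :* (x :* z)) refl

deltaℚ-refl : ∀ q → deltaℚ q q ≡ 1ℚ
deltaℚ-refl q with q ℕ.≟ q
... | yes _   = refl
... | no q≢q = ⊥-elim (q≢q refl)

deltaℚ-≢ : ∀ {q W} → ¬ q ≡ W → deltaℚ q W ≡ 0ℚ
deltaℚ-≢ {q} {W} q≢W with q ℕ.≟ W
... | yes q≡W = ⊥-elim (q≢W q≡W)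
... | no _    = refl

deltaℚ-< : ∀ {q W} → q ℕ.< W → deltaℚ q W ≡ 0ℚ
deltaℚ-< q<W = deltaℚ-≢ (λ q≡W → ℕP.<-irrefl q≡W q<W)

deltaℚ-suc : ∀ q W → deltaℚ (suc q) (suc W) ≡ deltaℚ q W
deltaℚ-suc q W with q ℕ.≟ W
... | yes refl = deltaℚ-refl (suc q)
... | no q≢W   = deltaℚ-≢ (λ q+1≡W+1 → q≢W (ℕP.suc-injective q+1≡W+1))

deltaℚ-weight : ∀ q W x → ℕtoℚ W * (x * deltaℚ q W) ≡ ℕtoℚ q * (x * deltaℚ q W)
deltaℚ-weight q W x with q ℕ.≟ W
... | yes refl = refl
... | no _     = trans (cong (ℕtoℚ W *_) (ℚP.*-zeroʳ x)) (trans (ℚP.*-zeroʳ (ℕtoℚ W))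
  (sym (trans (cong (ℕtoℚ q *_) (ℚP.*-zeroʳ x)) (ℚP.*-zeroʳ (ℕtoℚ q)))))

-- Only the empty tuple has weight 0.
expSum-deltaℚ-zero : ∀ b o m (g : ℕ → ℚ) → expSum b o m (λ K W → g K * deltaℚ 0 W) ≡ g 0
expSum-deltaℚ-zero b o zero    g = ℚP.*-identityʳ (g 0)
expSum-deltaℚ-zero b o (suc m) g = begin
  expSum b o (suc m) (λ K W → g K * deltaℚ 0 W)
    ≡⟨ sumUpTo-head b (λ j → trans
         (cong (expWeight (suc o) (suc j) *_) (expSum-zero b (suc o) m (λ K W →
           trans (cong (g (suc j ℕ.+ K) *_) (deltaℚ-< (ℕP.<-≤-trans (s≤s z≤n) (ℕP.m≤m+n (suc o ℕ.* suc j) W))))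
             (ℚP.*-zeroʳ (g (suc j ℕ.+ K))))))
         (ℚP.*-zeroʳ (expWeight (suc o) (suc j)))) ⟩
  1ℚ * expSum b (suc o) m (λ K W → g K * deltaℚ 0 (suc o ℕ.* 0 ℕ.+ W))
    ≡⟨ ℚP.*-identityˡ _ ⟩
  expSum b (suc o) m (λ K W → g K * deltaℚ 0 (suc o ℕ.* 0 ℕ.+ W))
    ≡⟨ expSum-cong b (suc o) m (λ K W → cong (λ x → g K * deltaℚ 0 (x ℕ.+ W)) (ℕP.*-zeroʳ (suc o))) ⟩
  expSum b (suc o) m (λ K W → g K * deltaℚ 0 W)
    ≡⟨ expSum-deltaℚ-zero b (suc o) m g ⟩
  g 0 ∎
  where open ≡-Reasoning

-- Coefficients of (t/(e^t - 1))^(a+1)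

risingAt : ℕ → ℕ → ℕ → ℕ → ℚ
risingAt a q K W = rising a K * deltaℚ q W

-- Since Σ_K C(a+K, K) h^K = (1 - h)^-(a+1) = (t/(e^t - 1))^(a+1), Φ↓ B a q i is
-- the coefficient of t^(q - i) in that series (0 if i > q), provided q ≤ B.
Φ↓ : ℕ → ℕ → ℕ → ℕ → ℚ
Φ↓ B a q i = expSum B 0 B (λ K W → rising a K * deltaℚ q (i ℕ.+ W))

Φ : ℕ → ℕ → ℕ → ℚ
Φ B a q = Φ↓ B a q 0

Φ-zero : ∀ B a → Φ B a 0 ≡ 1ℚ
Φ-zero B a = trans (expSum-deltaℚ-zero B 0 B (rising a)) (rising-zero a)

Φ↓-suc-suc : ∀ B a q i → Φ↓ B a (suc q) (suc i) ≡ Φ↓ B a q i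
Φ↓-suc-suc B a q i = expSum-cong B 0 B (λ K W → cong (rising a K *_) (deltaℚ-suc q (i ℕ.+ W)))

Φ↓-> : ∀ B a {q i} → q ℕ.< i → Φ↓ B a q i ≡ 0ℚ
Φ↓-> B a {q} {i} q<i = expSum-zero B 0 B (λ K W →
  trans (cong (rising a K *_) (deltaℚ-< (ℕP.<-≤-trans q<i (ℕP.m≤m+n i W)))) (ℚP.*-zeroʳ (rising a K)))

risingAt-vanishesAbove : ∀ a q → VanishesAbove q (risingAt a q)
risingAt-vanishesAbove a q K W q<W = trans (cong (rising a K *_) (deltaℚ-< q<W)) (ℚP.*-zeroʳ (rising a K))

expSum-mulXT-risingAt : ∀ B a q i →
  expSum B 0 B (mulXT i (risingAt a q)) ≡ ℕtoℚ (suc a) * Φ↓ B (suc a) q i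
expSum-mulXT-risingAt B a q i = trans
  (expSum-cong B 0 B (λ K W → trans (cong (_* deltaℚ q (i ℕ.+ W)) (rising-suc-first a K))
    (ℚP.*-assoc (ℕtoℚ (suc a)) (rising (suc a) K) (deltaℚ q (i ℕ.+ W)))))
  (sym (*-distribˡ-expSum B 0 B (ℕtoℚ (suc a)) _))

K*rising : ∀ a K → ℕtoℚ K * rising a K ≡ ℕtoℚ (suc a) * rising (suc a) K + - ℕtoℚ (suc a) * rising a K
K*rising a K = begin
  ℕtoℚ K * rising a K                        ≡⟨ split (ℕtoℚ (suc a)) (ℕtoℚ K) (rising a K) ⟩
  (N + ℕtoℚ K) * rising a K + - N * rising a K
    ≡⟨ cong (λ x → x * rising a K + - N * rising a K) (ℕtoℚ-homo-+ (suc a) K) ⟨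
  ℕtoℚ (suc a ℕ.+ K) * rising a K + - N * rising a K
    ≡⟨ cong (_+ - N * rising a K) (trans (sym (rising-suc-last a K)) (rising-suc-first a K)) ⟩
  N * rising (suc a) K + - N * rising a K    ∎
  where
  open ≡-Reasoning
  N = ℕtoℚ (suc a)
  split : ∀ N K G → K * G ≡ (N + K) * G + - N * G
  split = solve 3 (λ N K G → K :* G := (N :+ K) :* G :+ :- N :* G) refl

Φᴷ : ℕ → ℕ → ℕ → ℚ
Φᴷ B a q = expSum B 0 B (λ K W → ℕtoℚ K * risingAt a q K W)

Φᴷ-rising : ∀ B a q → Φᴷ B a q ≡ ℕtoℚ (suc a) * Φ B (suc a) q + - ℕtoℚ (suc a) * Φ B a q
Φᴷ-rising B a q = begin
  Φᴷ B a q
    ≡⟨ expSum-cong B 0 B (λ K W → trans (sym (ℚP.*-assoc (ℕtoℚ K) (rising a K) (deltaℚ q W)))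
         (trans (cong (_* deltaℚ q W) (K*rising a K)) (distribute N (rising (suc a) K) (rising a K) (deltaℚ q W)))) ⟩
  expSum B 0 B (λ K W → N * risingAt (suc a) q K W + - N * risingAt a q K W)
    ≡⟨ expSum-distrib-+ B 0 B _ _ ⟩
  expSum B 0 B (λ K W → N * risingAt (suc a) q K W) + expSum B 0 B (λ K W → - N * risingAt a q K W)
    ≡⟨ cong₂ _+_ (*-distribˡ-expSum B 0 B N _) (*-distribˡ-expSum B 0 B (- N) _) ⟨
  N * Φ B (suc a) q + - N * Φ B a q ∎
  where
  open ≡-Reasoning
  N = ℕtoℚ (suc a)
  distribute : ∀ N G′ G d → (N * G′ + - N * G) * d ≡ N * (G′ * d) + - N * (G * d)
  distribute = solve 4 (λ N G′ G d → (N :* G′ :+ :- N :* G) :* d := N :* (G′ :* d) :+ :- N :* (G :* d)) refl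

Φᴷ-x∂ₓ : ∀ {B q} a → q ℕ.≤ B →
  Φᴷ B a q ≡ - ℕtoℚ (suc a) * sumRange 0 B (λ i → invFact (suc i) * Φ↓ B (suc a) q i)
Φᴷ-x∂ₓ {B} {q} a q≤B = begin
  Φᴷ B a q
    ≡⟨ expSum-cong B 0 B (λ K W → pad (ℕtoℚ K) (ℕtoℚ W) (risingAt a q K W)) ⟩
  expSum B 0 B (λ K W → (1ℚ * ℕtoℚ K + 0ℚ * ℕtoℚ W) * risingAt a q K W)
    ≡⟨ expSum-euler 1ℚ 0ℚ q≤B B 0 (risingAt a q) (risingAt-vanishesAbove a q) ⟩
  sumRange 0 B (λ i → (1ℚ + 0ℚ * ℕtoℚ i) * hCoeff i * expSum B 0 B (mulXT i (risingAt a q)))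
    ≡⟨ sumRange-cong 0 B (λ i → trans (cong ((1ℚ + 0ℚ * ℕtoℚ i) * hCoeff i *_) (expSum-mulXT-risingAt B a q i))
         (simplify (ℕtoℚ i) (invFact (suc i)) (ℕtoℚ (suc a)) (Φ↓ B (suc a) q i))) ⟩
  sumRange 0 B (λ i → - ℕtoℚ (suc a) * (invFact (suc i) * Φ↓ B (suc a) q i))
    ≡⟨ *-distribˡ-sumRange 0 B (- ℕtoℚ (suc a)) _ ⟨
  - ℕtoℚ (suc a) * sumRange 0 B (λ i → invFact (suc i) * Φ↓ B (suc a) q i) ∎
  where
  open ≡-Reasoning
  pad : ∀ K W x → K * x ≡ (1ℚ * K + 0ℚ * W) * x
  pad = solve 3 (λ K W x → K :* x := (con 1ℚ :* K :+ con 0ℚ :* W) :* x) refl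
  simplify : ∀ i f N y → (1ℚ + 0ℚ * i) * - f * (N * y) ≡ - N * (f * y)
  simplify = solve 4 (λ i f N y → (con 1ℚ :+ con 0ℚ :* i) :* :- f :* (N :* y) := :- N :* (f :* y)) refl

Φᴷ-x∂ₓ+t∂ₜ : ∀ {B q} a → q ℕ.≤ B →
  Φᴷ B a q + ℕtoℚ q * Φ B a q ≡ - ℕtoℚ (suc a) * sumRange 0 B (λ i → invFact i * Φ↓ B (suc a) q i)
Φᴷ-x∂ₓ+t∂ₜ {B} {q} a q≤B = begin
  Φᴷ B a q + ℕtoℚ q * Φ B a q
    ≡⟨ cong (λ x → Φᴷ B a q + x) (*-distribˡ-expSum B 0 B (ℕtoℚ q) (risingAt a q)) ⟩
  Φᴷ B a q + expSum B 0 B (λ K W → ℕtoℚ q * risingAt a q K W)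
    ≡⟨ expSum-distrib-+ B 0 B _ _ ⟨
  expSum B 0 B (λ K W → ℕtoℚ K * risingAt a q K W + ℕtoℚ q * risingAt a q K W)
    ≡⟨ expSum-cong B 0 B (λ K W → trans
         (cong (λ x → ℕtoℚ K * risingAt a q K W + x) (sym (deltaℚ-weight q W (rising a K))))
         (pad (ℕtoℚ K) (ℕtoℚ W) (risingAt a q K W))) ⟩
  expSum B 0 B (λ K W → (1ℚ * ℕtoℚ K + 1ℚ * ℕtoℚ W) * risingAt a q K W)
    ≡⟨ expSum-euler 1ℚ 1ℚ q≤B B 0 (risingAt a q) (risingAt-vanishesAbove a q) ⟩
  sumRange 0 B (λ i → (1ℚ + 1ℚ * ℕtoℚ i) * hCoeff i * expSum B 0 B (mulXT i (risingAt a q)))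
    ≡⟨ sumRange-cong 0 B (λ i → trans (cong₂ _*_ (coefficient i) (expSum-mulXT-risingAt B a q i))
         (swap (invFact i) (ℕtoℚ (suc a)) (Φ↓ B (suc a) q i))) ⟩
  sumRange 0 B (λ i → - ℕtoℚ (suc a) * (invFact i * Φ↓ B (suc a) q i))
    ≡⟨ *-distribˡ-sumRange 0 B (- ℕtoℚ (suc a)) _ ⟨
  - ℕtoℚ (suc a) * sumRange 0 B (λ i → invFact i * Φ↓ B (suc a) q i) ∎
  where
  open ≡-Reasoning
  pad : ∀ K W x → K * x + W * x ≡ (1ℚ * K + 1ℚ * W) * x
  pad = solve 3 (λ K W x → K :* x :+ W :* x := (con 1ℚ :* K :+ con 1ℚ :* W) :* x) refl
  coefficient : ∀ i → (1ℚ + 1ℚ * ℕtoℚ i) * hCoeff i ≡ - invFact i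
  coefficient i = trans (collect (ℕtoℚ i) (invFact (suc i)))
    (cong -_ (trans (cong (invFact (suc i) *_) (sym (ℕtoℚ-homo-+ 1 i))) (invFact-suc i)))
    where
    collect : ∀ x f → (1ℚ + 1ℚ * x) * - f ≡ - (f * (1ℚ + x))
    collect = solve 2 (λ x f → (con 1ℚ :+ con 1ℚ :* x) :* :- f := :- (f :* (con 1ℚ :+ x))) refl
  swap : ∀ f N y → - f * (N * y) ≡ - N * (f * y)
  swap = solve 3 (λ f N y → :- f :* (N :* y) := :- N :* (f :* y)) refl

sumRange-Φ↓-reindex : ∀ {B q} a → q ℕ.< B →
  sumRange 0 B (λ i → invFact i * Φ↓ B a (suc q) i)
  ≡ Φ B a q + sumRange 0 B (λ i → invFact (suc i) * Φ↓ B a q i)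
sumRange-Φ↓-reindex {suc B′} {q} a (s≤s q≤B′) = begin
  invFact 1 * Φ↓ B a (suc q) 1 + sumRange 1 B′ (λ i → invFact i * Φ↓ B a (suc q) i)
    ≡⟨ cong₂ _+_ (trans (cong (_* Φ↓ B a (suc q) 1) invFact-one) (ℚP.*-identityˡ (Φ↓ B a (suc q) 1)))
         (sumRange-suc 0 B′ _) ⟩
  Φ↓ B a (suc q) 1 + sumRange 0 B′ (λ i → invFact (suc i) * Φ↓ B a (suc q) (suc i))
    ≡⟨ cong₂ _+_ (Φ↓-suc-suc B a q 0)
         (sumRange-cong 0 B′ (λ i → cong (invFact (suc i) *_) (Φ↓-suc-suc B a q i))) ⟩
  Φ B a q + sumRange 0 B′ g
    ≡⟨ cong (λ x → Φ B a q + x) (ℚP.+-identityʳ (sumRange 0 B′ g)) ⟨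
  Φ B a q + (sumRange 0 B′ g + 0ℚ)
    ≡⟨ cong (λ x → Φ B a q + (sumRange 0 B′ g + x)) g-top ⟨
  Φ B a q + (sumRange 0 B′ g + g (suc B′))
    ≡⟨ cong (λ x → Φ B a q + x) (sumRange-snoc 0 B′ g) ⟨
  Φ B a q + sumRange 0 B g ∎
  where
  open ≡-Reasoning
  B = suc B′
  g : ℕ → ℚ
  g i = invFact (suc i) * Φ↓ B a q i
  g-top : g (suc B′) ≡ 0ℚ
  g-top = trans (cong (invFact (suc (suc B′)) *_) (Φ↓-> B a (s≤s q≤B′))) (ℚP.*-zeroʳ (invFact (suc (suc B′))))

-- The coefficient form of t F′ = F - t F - F² for F = t/(e^t - 1).
Φ-rec : ∀ {B q} a → q ℕ.< B →
  ℕtoℚ (suc a) * Φ B (suc a) (suc q)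
  ≡ (ℕtoℚ (suc a) + - ℕtoℚ (suc q)) * Φ B a (suc q) + - ℕtoℚ (suc a) * Φ B a q
Φ-rec {B} {q} a q<B = combine (ℕtoℚ (suc a)) (ℕtoℚ (suc q))
  (Φ B (suc a) (suc q)) (Φ B a (suc q)) (Φ B (suc a) q) (Φ B a q) _ _ _ _
  (Φᴷ-x∂ₓ+t∂ₜ a q<B) (Φᴷ-x∂ₓ a (ℕP.<⇒≤ q<B))
  (Φᴷ-rising B a (suc q)) (Φᴷ-rising B a q) (sumRange-Φ↓-reindex (suc a) q<B)
  where
  combine : ∀ N P x y u v S S⁺ k⁺ k →
    k⁺ + P * y ≡ - N * S⁺ → k ≡ - N * S →
    k⁺ ≡ N * x + - N * y → k ≡ N * u + - N * v → S⁺ ≡ u + S →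
    N * x ≡ (N + - P) * y + - N * v
  combine N P x y u v S _ _ _ h⁺ h refl refl refl = begin
    N * x                                     ≡⟨ step₁ N P x y ⟩
    (N * x + - N * y + P * y) + (N + - P) * y ≡⟨ cong (_+ (N + - P) * y) h⁺ ⟩
    - N * (u + S) + (N + - P) * y             ≡⟨ step₂ N P y u S ⟩
    - N * u + - N * S + (N + - P) * y         ≡⟨ cong (λ z → - N * u + z + (N + - P) * y) h ⟨
    - N * u + (N * u + - N * v) + (N + - P) * y ≡⟨ step₃ N P y u v ⟩
    (N + - P) * y + - N * v                   ∎
    where
    open ≡-Reasoning
    step₁ : ∀ N P x y → N * x ≡ (N * x + - N * y + P * y) + (N + - P) * y
    step₁ = solve 4 (λ N P x y → N :* x := (N :* x :+ :- N :* y :+ P :* y) :+ (N :+ :- P) :* y) refl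
    step₂ : ∀ N P y u S → - N * (u + S) + (N + - P) * y ≡ - N * u + - N * S + (N + - P) * y
    step₂ = solve 5 (λ N P y u S →
      :- N :* (u :+ S) :+ (N :+ :- P) :* y := :- N :* u :+ :- N :* S :+ (N :+ :- P) :* y) refl
    step₃ : ∀ N P y u v → - N * u + (N * u + - N * v) + (N + - P) * y ≡ (N + - P) * y + - N * v
    step₃ = solve 5 (λ N P y u v →
      :- N :* u :+ (N :* u :+ :- N :* v) :+ (N :+ :- P) :* y := (N :+ :- P) :* y :+ :- N :* v) refl

-- The Stirling numbers as coefficients

stirling1-step : ∀ {B} q r → q ℕ.< B →
  fromℤ (stirling1 (suc (q ℕ.+ r)) r)
    ≡ ℕtoℚ ((q ℕ.+ r) !) * invFact r * ℕtoℚ r * Φ B (q ℕ.+ r) (suc q) →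
  fromℤ (stirling1 (suc (q ℕ.+ r)) (suc r))
    ≡ ℕtoℚ ((q ℕ.+ r) !) * invFact r * Φ B (q ℕ.+ r) q →
  fromℤ (stirling1 (suc (suc (q ℕ.+ r))) (suc r))
    ≡ ℕtoℚ (suc (q ℕ.+ r) !) * invFact r * Φ B (suc (q ℕ.+ r)) (suc q)
stirling1-step {B} q r q<B s[n,r] s[n,r+1] = begin
  fromℤ (stirling1 (suc n) (suc r))
    ≡⟨ fromℤ-stirling1-suc-suc n r ⟩
  fromℤ (stirling1 n r) + - N * fromℤ (stirling1 n (suc r))
    ≡⟨ cong₂ (λ x y → x + - N * y) s[n,r] s[n,r+1] ⟩
  X * I * R * Φ B a (suc q) + - N * (X * I * Φ B a q)
    ≡⟨ regroup X I R N (Φ B a (suc q)) (Φ B a q) ⟩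
  X * I * (R * Φ B a (suc q) + - N * Φ B a q)
    ≡⟨ cong (λ x → X * I * (x * Φ B a (suc q) + - N * Φ B a q)) R≡N-[q+1] ⟩
  X * I * ((N + - ℕtoℚ (suc q)) * Φ B a (suc q) + - N * Φ B a q)
    ≡⟨ cong (X * I *_) (Φ-rec a q<B) ⟨
  X * I * (N * Φ B n (suc q))
    ≡⟨ shuffle X I N (Φ B n (suc q)) ⟩
  N * X * I * Φ B n (suc q)
    ≡⟨ cong (λ x → x * I * Φ B n (suc q)) (ℕtoℚ-homo-* n (a !)) ⟨
  ℕtoℚ (n !) * I * Φ B n (suc q) ∎
  where
  open ≡-Reasoning
  a = q ℕ.+ r
  n = suc a
  N = ℕtoℚ n
  X = ℕtoℚ (a !)
  I = invFact r
  R = ℕtoℚ r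
  R≡N-[q+1] : R ≡ N + - ℕtoℚ (suc q)
  R≡N-[q+1] = trans (cancel (ℕtoℚ (suc q)) R) (cong (_+ - ℕtoℚ (suc q)) (sym (ℕtoℚ-homo-+ (suc q) r)))
    where
    cancel : ∀ P R → R ≡ P + R + - P
    cancel = solve 2 (λ P R → R := P :+ R :+ :- P) refl
  regroup : ∀ X I R N y z → X * I * R * y + - N * (X * I * z) ≡ X * I * (R * y + - N * z)
  regroup = solve 6 (λ X I R N y z → X :* I :* R :* y :+ :- N :* (X :* I :* z) := X :* I :* (R :* y :+ :- N :* z)) refl
  shuffle : ∀ X I N y → X * I * (N * y) ≡ N * X * I * y
  shuffle = solve 4 (λ X I N y → X :* I :* (N :* y) := N :* X :* I :* y) refl

stirling1≡Φ : ∀ {B} q r → q ℕ.≤ B →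
  fromℤ (stirling1 (suc (q ℕ.+ r)) (suc r)) ≡ ℕtoℚ ((q ℕ.+ r) !) * invFact r * Φ B (q ℕ.+ r) q
stirling1≡Φ {B} zero r _ = begin
  fromℤ (stirling1 (suc r) (suc r))        ≡⟨ cong fromℤ (stirling1-diag (suc r)) ⟩
  1ℚ                                       ≡⟨ trans (ℚP.*-comm (ℕtoℚ (r !)) (invFact r)) (invFact-inverseˡ r) ⟨
  ℕtoℚ (r !) * invFact r                   ≡⟨ ℚP.*-identityʳ _ ⟨
  ℕtoℚ (r !) * invFact r * 1ℚ              ≡⟨ cong (ℕtoℚ (r !) * invFact r *_) (Φ-zero B r) ⟨
  ℕtoℚ (r !) * invFact r * Φ B r 0         ∎
  where open ≡-Reasoning
stirling1≡Φ {B} (suc q) zero q<B =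
  stirling1-step q 0 q<B s[n,0] (stirling1≡Φ q 0 (ℕP.<⇒≤ q<B))
  where
  annihilate : ∀ x y z → x * y * 0ℚ * z ≡ 0ℚ
  annihilate = solve 3 (λ x y z → x :* y :* con 0ℚ :* z := con 0ℚ) refl
  s[n,0] : fromℤ (stirling1 (suc (q ℕ.+ 0)) 0)
         ≡ ℕtoℚ ((q ℕ.+ 0) !) * invFact 0 * ℕtoℚ 0 * Φ B (q ℕ.+ 0) (suc q)
  s[n,0] = trans (cong fromℤ (stirling1-suc-zero (q ℕ.+ 0)))
    (sym (annihilate (ℕtoℚ ((q ℕ.+ 0) !)) (invFact 0) (Φ B (q ℕ.+ 0) (suc q))))
stirling1≡Φ {B} (suc q) (suc r) q<B =
  stirling1-step q (suc r) q<B s[n,r] (stirling1≡Φ q (suc r) (ℕP.<⇒≤ q<B))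
  where
  s[n,r] : fromℤ (stirling1 (suc (q ℕ.+ suc r)) (suc r))
         ≡ ℕtoℚ ((q ℕ.+ suc r) !) * invFact (suc r) * ℕtoℚ (suc r) * Φ B (q ℕ.+ suc r) (suc q)
  s[n,r] = trans
    (subst (λ a → fromℤ (stirling1 (suc a) (suc r)) ≡ ℕtoℚ (a !) * invFact r * Φ B a (suc q))
      (sym (ℕP.+-suc q r)) (stirling1≡Φ (suc q) r q<B))
    (cong (_* Φ B (q ℕ.+ suc r) (suc q)) (trans
      (cong (ℕtoℚ ((q ℕ.+ suc r) !) *_) (sym (invFact-suc r)))
      (sym (ℚP.*-assoc (ℕtoℚ ((q ℕ.+ suc r) !)) (invFact (suc r)) (ℕtoℚ (suc r))))))

sumTuples-summand≡Φ : ∀ a p → sumTuples p p (summand (suc a) p) ≡ Φ p a p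
sumTuples-summand≡Φ a p = trans
  (sumTuples-cong p p (λ ks → regroup (ℕtoℚ ((a ℕ.+ totalK ks) C totalK ks)) (ℕtoℚ (totalK ks !))
    (prodInvFact ks) (deltaℚ p (weightedSum 0 ks)) (powProd 0 ks)))
  (sumTuples≡expSum p p 0 (risingAt a p))
  where
  regroup : ∀ c f y d w → c * (f * y) * d * w ≡ (c * f) * d * (y * w)
  regroup = solve 5 (λ c f y d w → c :* (f :* y) :* d :* w := (c :* f) :* d :* (y :* w)) refl

mainTheorem13 : (n p : ℕ) → 1 ≤ n → p ≤ n ∸ 1 →
    fromℤ (stirling1 n (n ∸ p)) ≡ stirlingRHS n p
mainTheorem13 (suc a) p (s≤s z≤n) p≤a with ℕP.m≤n⇒∃[o]m+o≡n p≤a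
... | r , refl = begin
  fromℤ (stirling1 (suc (p ℕ.+ r)) (suc (p ℕ.+ r) ∸ p))
    ≡⟨ cong (λ k → fromℤ (stirling1 (suc (p ℕ.+ r)) k)) n∸p≡r+1 ⟩
  fromℤ (stirling1 (suc (p ℕ.+ r)) (suc r))
    ≡⟨ stirling1≡Φ p r ℕP.≤-refl ⟩
  ℕtoℚ ((p ℕ.+ r) !) * invFact r * Φ p (p ℕ.+ r) p
    ≡⟨ cong₂ _*_ (divFact≡*invFact ((p ℕ.+ r) !) r) (sumTuples-summand≡Φ (p ℕ.+ r) p) ⟨
  divFact ((p ℕ.+ r) !) r * sumTuples p p (summand (suc (p ℕ.+ r)) p)
    ≡⟨ cong (λ k → divFact ((p ℕ.+ r) !) (k ∸ 1) * sumTuples p p (summand (suc (p ℕ.+ r)) p)) n∸p≡r+1 ⟨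
  stirlingRHS (suc (p ℕ.+ r)) p ∎
  where
  open ≡-Reasoning
  n∸p≡r+1 : suc (p ℕ.+ r) ∸ p ≡ suc r
  n∸p≡r+1 = trans (cong (_∸ p) (sym (ℕP.+-suc p r))) (ℕP.m+n∸m≡n p (suc r))
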